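{- Let $H$ be a hyperplane of $T$ and let $u\in V'$. Then: (1) if $ru\in H$, then $|\{[u+h] : h\in H\}|=|H|/q$; (2) if $ru\notin H$, then $|\{[u+h] : h\in H\}|=|H|$.
   Context: Let $e\geq 2$ and let $K$ be a finite commutative ring with identity having precisely three ideals $\{0\}$, $J=\langle r\rangle$, $K$, with $K/J\cong\mathbb{F}_q$ ($q$ a prime power); then $|J|=q$, $|K|=q^2$. Let $K^\times$ be the set of units, $V'$ the set of tuples in $K^{2e}$ with at least one entry in $K^\times$, and for $a\in V'$ let $[a]=\{\lambda a:\lambda\in K^\times\}$. Let $T=J^{2e}$; it is a $2e$-dimensional vector space over $K/J$ with scalar multiplication $(z+J)\cdot x=zx$ (well defined since $J\cdot J=0$). A hyperplane is a $(2e-1)$-dimensional subspace of $T$. For $u\in K^{2e}$, $ru$ denotes the componentwise product, an element of $T$. -}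

module Defs where

open import Level using (0ℓ)
open import Algebra.Bundles using (CommutativeRing)
open import Data.Nat as ℕ using (ℕ; zero; suc)
open import Data.Fin using (Fin; zero; suc)
open import Data.Product using (Σ; ∃; _×_; _,_)
open import Data.Sum using (_⊎_)
open import Data.Unit using (⊤)
open import Relation.Nullary using (¬_)
open import Relation.Binary.PropositionalEquality using (_≡_)

-- "P has exactly n elements up to the equivalence _∼_":
-- an enumeration of n elements of P, pairwise non-equivalent, covering P.
-- With _∼_ an equality this is |P| = n; with _∼_ being "f a = f b" it is |f(P)| = n.
record Count {A : Set} (P : A → Set) (_∼_ : A → A → Set) (n : ℕ) : Set where
  field
    elt      : Fin n → A
    inP      : ∀ i → P (elt i)
    distinct : ∀ i j → elt i ∼ elt j → i ≡ j
    cover    : ∀ a → P a → ∃ λ i → a ∼ elt i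

module _ (R : CommutativeRing 0ℓ 0ℓ) where
  open CommutativeRing R using (_≈_; _+_; _*_; _-_; 0#; 1#) renaming (Carrier to K)

  IsFinite : Set
  IsFinite = ∃ λ k → Count {K} (λ _ → ⊤) _≈_ k

  IsIdeal : (K → Set) → Set
  IsIdeal I = (∀ {x y} → x ≈ y → I x → I y) × I 0#
            × (∀ {x y} → I x → I y → I (x + y)) × (∀ a {x} → I x → I (a * x))

  SameSet : (K → Set) → (K → Set) → Set
  SameSet I I' = ∀ x → (I x → I' x) × (I' x → I x)

  ZeroIdeal : K → Set
  ZeroIdeal x = x ≈ 0#

  WholeIdeal : K → Set
  WholeIdeal _ = ⊤

  Principal : K → K → Set
  Principal r x = ∃ λ y → x ≈ y * r

  IsUnit : K → Set
  IsUnit x = ∃ λ y → x * y ≈ 1#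

  ExactlyThreeIdeals : K → Set₁
  ExactlyThreeIdeals r =
      ¬ SameSet (Principal r) ZeroIdeal × ¬ SameSet (Principal r) WholeIdeal
    × (∀ I → IsIdeal I → SameSet I ZeroIdeal ⊎ SameSet I (Principal r) ⊎ SameSet I WholeIdeal)

  QuotientCard : K → ℕ → Set
  QuotientCard r q = Count {K} (λ _ → ⊤) (λ x y → Principal r (x - y)) q

  Tup : ℕ → Set
  Tup n = Fin n → K

  _≋_ : ∀ {n} → Tup n → Tup n → Set
  v ≋ w = ∀ j → v j ≈ w j

  _⊕_ : ∀ {n} → Tup n → Tup n → Tup n
  (v ⊕ w) j = v j + w j

  scale : ∀ {n} → K → Tup n → Tup n
  scale a v j = a * v j

  zeroT : ∀ {n} → Tup n
  zeroT _ = 0#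

  InT : K → ∀ {n} → Tup n → Set
  InT r v = ∀ j → Principal r (v j)

  -- subspace of T (as a K/J-vector space; scalars z + J act by z·x)
  IsSubspace : K → ∀ {n} → (Tup n → Set) → Set
  IsSubspace r {n} H = (∀ {v w} → v ≋ w → H v → H w) × (∀ v → H v → InT r v)
    × H zeroT × (∀ v w → H v → H w → H (v ⊕ w)) × (∀ a v → H v → H (scale a v))

  sumFin : ∀ d → (Fin d → K) → K
  sumFin zero    f = 0#
  sumFin (suc d) f = f zero + sumFin d (λ i → f (suc i))

  linComb : ∀ {n d} → (Fin d → K) → (Fin d → Tup n) → Tup n
  linComb {d = d} c b j = sumFin d (λ i → c i * b i j)

  -- H has a basis of size d over K/J (coefficient c is zero in K/J iff c ∈ J)
  HasBasis : K → ∀ {n} → (Tup n → Set) → ℕ → Set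
  HasBasis r {n} H d = Σ (Fin d → Tup n) λ b →
      (∀ i → H (b i))
    × (∀ v → H v → ∃ λ (c : Fin d → K) → v ≋ linComb c b)
    × (∀ (c : Fin d → K) → linComb c b ≋ zeroT → ∀ i → Principal r (c i))

  -- a hyperplane of T = J^(2e): a (2e-1)-dimensional subspace
  IsHyperplane : K → (e : ℕ) → (Tup (2 ℕ.* e) → Set) → Set
  IsHyperplane r e H = IsSubspace r H × HasBasis r H (2 ℕ.* e ℕ.∸ 1)

  InV' : ∀ {n} → Tup n → Set
  InV' u = ∃ λ j → IsUnit (u j)

  InClass : ∀ {n} → Tup n → Tup n → Set
  InClass a x = ∃ λ l → IsUnit l × x ≋ scale l a

  SameClass : ∀ {n} → Tup n → Tup n → Set
  SameClass a b = ∀ x → (InClass a x → InClass b x) × (InClass b x → InClass a x)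

{-# OPTIONS --safe #-}
module Submission where

-- K is local with maximal ideal J = ⟨r⟩ and J² = 0, so r kills T = J^(2e). If
-- λ(u + h) = u + h' with h, h' ∈ T, reading this modulo J at a unit coordinate of u
-- gives λ = 1 + s r, hence h' = h + s·ru; conversely every 1 + s r is a unit. So
-- [u + h] = [u + h'] iff h' = h + s·ru for some s, and s·ru = 0 when s ∈ J. If ru ∉ H,
-- no unit multiple of ru is a difference of elements of H, so the classes are the
-- elements of H. If ru ∈ H, ru has a unit coordinate γᵢ₀ in a basis of H, and the
-- elements of H whose i₀-th coordinate is 0 represent every class exactly once.

open import Defs
open import Level using (0ℓ)
open import Algebra.Bundles using (CommutativeRing)
open import Data.Nat using (ℕ; zero; suc; _^_)
import Data.Nat as ℕ
import Data.Nat.Properties as ℕₚ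
open import Data.Fin using (Fin; zero; suc; combine; funToFin; finToFun; punchIn)
open import Data.Fin.Properties using (funToFin-finToFin; finToFun-funToFin; any?)
open import Data.Vec.Functional using (Vector; insertAt; removeAt)
open import Data.Vec.Functional.Properties using (insertAt-lookup; insertAt-punchIn; insertAt-removeAt)
open import Data.Product using (∃; ∃₂; _×_; _,_; proj₁; proj₂)
open import Data.Sum using (_⊎_; inj₁; inj₂; [_,_]′)
open import Data.Unit using (tt)
open import Data.Empty using (⊥-elim)
open import Relation.Binary using (Transitive)
open import Relation.Nullary using (¬_; Dec; yes; no)
open import Relation.Binary.PropositionalEquality as ≡ using (_≡_; _≗_)
open import Function using (_∘_; id)

funToFin-cong : ∀ {m n} {f g : Fin m → Fin n} → f ≗ g → funToFin f ≡ funToFin g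
funToFin-cong {zero}  f≗g = ≡.refl
funToFin-cong {suc m} f≗g = ≡.cong₂ combine (f≗g zero) (funToFin-cong (f≗g ∘ suc))

insertAt-pointwise : ∀ {A : Set} (_~_ : A → A → Set) {n} {xs ys : Vector A n} {x y} →
  (∀ j → xs j ~ ys j) → ∀ i → x ~ y → ∀ j → insertAt xs i x j ~ insertAt ys i y j
insertAt-pointwise _~_             xs~ys zero    x~y zero    = x~y
insertAt-pointwise _~_             xs~ys zero    x~y (suc j) = xs~ys j
insertAt-pointwise _~_ {n = suc n} xs~ys (suc i) x~y zero    = xs~ys zero
insertAt-pointwise _~_ {n = suc n} xs~ys (suc i) x~y (suc j) =
  insertAt-pointwise _~_ (xs~ys ∘ suc) i x~y j

module _ {A : Set} {P : A → Set} {_∼_ : A → A → Set} where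

  Count-fromFunctions : ∀ {d q} → Transitive _∼_ → (f : (Fin d → Fin q) → A) →
    (∀ {g g'} → g ≗ g' → f g ∼ f g') → (∀ g → P (f g)) →
    (∀ {g g'} → f g ∼ f g' → g ≗ g') → (∀ a → P a → ∃ λ g → a ∼ f g) →
    Count P _∼_ (q ^ d)
  Count-fromFunctions {d} {q} ∼-trans f f-cong f-P f-injective f-cover = record
    { elt      = f ∘ finToFun {q} {d}
    ; inP      = f-P ∘ finToFun {q} {d}
    ; distinct = λ i j e → begin
        i                             ≡⟨ funToFin-finToFin {d} i ⟨
        funToFin (finToFun {q} {d} i) ≡⟨ funToFin-cong (f-injective e) ⟩
        funToFin (finToFun {q} {d} j) ≡⟨ funToFin-finToFin {d} j ⟩
        j                             ∎
    ; cover    = λ a Pa → let (g , a∼fg) = f-cover a Pa in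
        funToFin g , ∼-trans a∼fg (f-cong (≡.sym ∘ finToFun-funToFin g))
    }
    where open ≡.≡-Reasoning

  Count-resp-⇔ : ∀ {_≈_ : A → A → Set} {n} →
    (∀ {a b} → P a → P b → a ≈ b → a ∼ b) → (∀ {a b} → P a → P b → a ∼ b → a ≈ b) →
    Count P _≈_ n → Count P _∼_ n
  Count-resp-⇔ ≈⇒∼ ∼⇒≈ c = record
    { elt      = elt
    ; inP      = inP
    ; distinct = λ i j e → distinct i j (∼⇒≈ (inP i) (inP j) e)
    ; cover    = λ a Pa → let (i , a≈eltᵢ) = cover a Pa in i , ≈⇒∼ Pa (inP i) a≈eltᵢ
    }
    where open Count c

module TupleAlgebra (R : CommutativeRing 0ℓ 0ℓ) where
  open CommutativeRing R hiding (zero) renaming (Carrier to K)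
  open import Algebra.Properties.Semiring.Sum semiring
    using (sum; sum-cong-≋; sum-replicate-zero; ∑-distrib-+; *-distribˡ-sum)
  open import Algebra.Properties.CommutativeSemigroup *-commutativeSemigroup using (interchange)
  open import Data.Vec.Functional.Relation.Binary.Equality.Setoid setoid public
    using (≋-sym; ≋-trans) renaming (_≋_ to _≐_)
  open import Relation.Binary.Reasoning.Setoid setoid

  infixl 6 _⊞_
  infixr 7 _·_

  _⊞_ : ∀ {n} → Tup R n → Tup R n → Tup R n
  _⊞_ = _⊕_ R

  _·_ : ∀ {n} → K → Tup R n → Tup R n
  _·_ = scale R

  unit-1 : IsUnit R 1#
  unit-1 = 1# , *-identityʳ 1#

  unit-* : ∀ {x y} → IsUnit R x → IsUnit R y → IsUnit R (x * y)
  unit-* {x} {y} (a , xa≈1) (b , yb≈1) = a * b , (begin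
    (x * y) * (a * b)   ≈⟨ interchange x y a b ⟩
    (x * a) * (y * b)   ≈⟨ *-cong xa≈1 yb≈1 ⟩
    1# * 1#             ≈⟨ *-identityʳ 1# ⟩
    1#                  ∎)

  module _ {n d : ℕ} (b : Fin d → Tup R n) where

    linComb≡sum : ∀ c j → linComb R c b j ≡ sum (λ i → c i * b i j)
    linComb≡sum c j = go d c b
      where
        go : ∀ d (c : Fin d → K) (b : Fin d → Tup R n) → linComb R c b j ≡ sum (λ i → c i * b i j)
        go zero    c b = ≡.refl
        go (suc d) c b = ≡.cong (c zero * b zero j +_) (go d (c ∘ suc) (b ∘ suc))

    linComb-termwise : ∀ {c c'} j → (∀ i → c i * b i j ≈ c' i * b i j) →
                       linComb R c b j ≈ linComb R c' b j
    linComb-termwise {c} {c'} j p = begin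
      linComb R c b j            ≡⟨ linComb≡sum c j ⟩
      sum (λ i → c i * b i j)    ≈⟨ sum-cong-≋ p ⟩
      sum (λ i → c' i * b i j)   ≡⟨ linComb≡sum c' j ⟨
      linComb R c' b j           ∎

    linComb-zero : ∀ {c} → (∀ i j → c i * b i j ≈ 0#) → linComb R c b ≐ zeroT R
    linComb-zero {c} p j = begin
      linComb R c b j           ≡⟨ linComb≡sum c j ⟩
      sum (λ i → c i * b i j)   ≈⟨ sum-cong-≋ (λ i → p i j) ⟩
      sum {d} (λ _ → 0#)        ≈⟨ sum-replicate-zero d ⟩
      0#                        ∎

    linComb-cong : ∀ {c c'} → c ≐ c' → linComb R c b ≐ linComb R c' b
    linComb-cong c≐c' j = linComb-termwise j λ i → *-congʳ (c≐c' i)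

    linComb-⊞ : ∀ c c' → linComb R (c ⊞ c') b ≐ linComb R c b ⊞ linComb R c' b
    linComb-⊞ c c' j = begin
      linComb R (c ⊞ c') b j
        ≡⟨ linComb≡sum (c ⊞ c') j ⟩
      sum (λ i → (c i + c' i) * b i j)
        ≈⟨ sum-cong-≋ (λ i → distribʳ (b i j) (c i) (c' i)) ⟩
      sum (λ i → c i * b i j + c' i * b i j)
        ≈⟨ ∑-distrib-+ (λ i → c i * b i j) (λ i → c' i * b i j) ⟩
      sum (λ i → c i * b i j) + sum (λ i → c' i * b i j)
        ≡⟨ ≡.cong₂ _+_ (linComb≡sum c j) (linComb≡sum c' j) ⟨
      linComb R c b j + linComb R c' b j
        ∎

    linComb-· : ∀ a c → linComb R (a · c) b ≐ a · linComb R c b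
    linComb-· a c j = begin
      linComb R (a · c) b j           ≡⟨ linComb≡sum (a · c) j ⟩
      sum (λ i → (a * c i) * b i j)   ≈⟨ sum-cong-≋ (λ i → *-assoc a (c i) (b i j)) ⟩
      sum (λ i → a * (c i * b i j))   ≈⟨ *-distribˡ-sum a (λ i → c i * b i j) ⟨
      a * sum (λ i → c i * b i j)     ≡⟨ ≡.cong (a *_) (linComb≡sum c j) ⟨
      a * linComb R c b j             ∎

  linComb-∈ : ∀ {r n d} {H : Tup R n → Set} → IsSubspace R r H →
              (c : Fin d → K) (b : Fin d → Tup R n) → (∀ i → H (b i)) → H (linComb R c b)
  linComb-∈ {d = zero}  (_ , _ , H-0 , _) c b b∈H = H-0
  linComb-∈ {d = suc d} H-sub@(_ , _ , _ , H-⊞ , H-·) c b b∈H =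
    H-⊞ _ _ (H-· (c zero) (b zero) (b∈H zero)) (linComb-∈ H-sub (c ∘ suc) (b ∘ suc) (b∈H ∘ suc))

  SameClass-trans : ∀ {n} {x y z : Tup R n} → SameClass R x y → SameClass R y z → SameClass R x z
  SameClass-trans x~y y~z w = (λ w∈[x] → proj₁ (y~z w) (proj₁ (x~y w) w∈[x]))
                            , (λ w∈[z] → proj₂ (x~y w) (proj₂ (y~z w) w∈[z]))

  sameClass-· : ∀ {n} {x y : Tup R n} {l} → IsUnit R l → y ≐ l · x → SameClass R x y
  sameClass-· {x = x} {y} {l} (w , lw≈1) y≐lx z = [x]⊆[y] , [y]⊆[x]
    where
      wl≈1 : w * l ≈ 1#
      wl≈1 = trans (*-comm w l) lw≈1
      x≐wy : x ≐ w · y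
      x≐wy j = begin
        x j             ≈⟨ *-identityˡ (x j) ⟨
        1# * x j        ≈⟨ *-congʳ wl≈1 ⟨
        (w * l) * x j   ≈⟨ *-assoc w l (x j) ⟩
        w * (l * x j)   ≈⟨ *-congˡ (y≐lx j) ⟨
        w * y j         ∎
      [x]⊆[y] : InClass R x z → InClass R y z
      [x]⊆[y] (m , m-unit , z≐mx) = m * w , unit-* m-unit (l , wl≈1) , λ j →
        trans (z≐mx j) (trans (*-congˡ (x≐wy j)) (sym (*-assoc m w (y j))))
      [y]⊆[x] : InClass R y z → InClass R x z
      [y]⊆[x] (m , m-unit , z≐my) = m * l , unit-* m-unit (w , lw≈1) , λ j →
        trans (z≐my j) (trans (*-congˡ (y≐lx j)) (sym (*-assoc m l (x j))))

  sameClass⇒· : ∀ {n} {x y : Tup R n} → SameClass R x y → ∃ λ l → IsUnit R l × y ≐ l · x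
  sameClass⇒· {y = y} x~y = proj₂ (x~y y) (1# , unit-1 , λ j → sym (*-identityˡ (y j)))

module LocalRing (R : CommutativeRing 0ℓ 0ℓ) (r : CommutativeRing.Carrier R)
                 (three : ExactlyThreeIdeals R r) where
  open CommutativeRing R hiding (zero) renaming (Carrier to K)
  open import Algebra.Properties.Ring ring
    using (-1*x≈-x; -‿distribʳ-*; [y-z]x≈yx-zx; xyx⁻¹≈y; x∙y⁻¹≈ε⇒x≈y)
  open import Algebra.Properties.CommutativeSemigroup *-commutativeSemigroup
    using (interchange; x∙yz≈y∙xz)
  open import Relation.Binary.Reasoning.Setoid setoid

  private variable x y z v : K

  J : K → Set
  J = Principal R r

  U : K → Set
  U = IsUnit R

  Principal-isIdeal : ∀ t → IsIdeal R (Principal R t)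
  Principal-isIdeal t =
      (λ x≈y (a , x≈at) → a , trans (sym x≈y) x≈at)
    , (0# , sym (zeroˡ t))
    , (λ (a , x≈at) (b , y≈bt) → a + b , trans (+-cong x≈at y≈bt) (sym (distribʳ t a b)))
    , (λ c (a , x≈at) → c * a , trans (*-congˡ x≈at) (sym (*-assoc c a t)))

  ∈Principal : ∀ t → Principal R t t
  ∈Principal t = 1# , sym (*-identityˡ t)

  J-resp : x ≈ y → J x → J y
  J-resp = proj₁ (Principal-isIdeal r)

  J-0 : J 0#
  J-0 = proj₁ (proj₂ (Principal-isIdeal r))

  J-+ : J x → J y → J (x + y)
  J-+ = proj₁ (proj₂ (proj₂ (Principal-isIdeal r)))

  J-*ˡ : ∀ a {x} → J x → J (a * x)
  J-*ˡ = proj₂ (proj₂ (proj₂ (Principal-isIdeal r)))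

  J-*ʳ : ∀ a {x} → J x → J (x * a)
  J-*ʳ a {x} jx = J-resp (*-comm a x) (J-*ˡ a jx)

  J-neg : J x → J (- x)
  J-neg {x} jx = J-resp (-1*x≈-x x) (J-*ˡ (- 1#) jx)

  J-− : J x → J y → J (x - y)
  J-− jx jy = J-+ jx (J-neg jy)

  J-r : J r
  J-r = ∈Principal r

  1∉J : ¬ J 1#
  1∉J (a , 1≈ar) = proj₁ (proj₂ three) λ x → (λ _ → tt) , λ _ → x * a , (begin
    x             ≈⟨ *-identityʳ x ⟨
    x * 1#        ≈⟨ *-congˡ 1≈ar ⟩
    x * (a * r)   ≈⟨ *-assoc x a r ⟨
    (x * a) * r   ∎)

  r≉0 : ¬ r ≈ 0#
  r≉0 r≈0 = proj₁ three λ x →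
      (λ (a , x≈ar) → trans x≈ar (trans (*-congˡ r≈0) (zeroʳ a)))
    , (λ x≈0 → J-resp (sym x≈0) J-0)

  J-or-unit : ∀ x → J x ⊎ U x
  J-or-unit x with proj₂ (proj₂ three) (Principal R x) (Principal-isIdeal x)
  ... | inj₁ ⟨x⟩≡0        = inj₁ (J-resp (sym (proj₁ (⟨x⟩≡0 x) (∈Principal x))) J-0)
  ... | inj₂ (inj₁ ⟨x⟩≡J) = inj₁ (proj₁ (⟨x⟩≡J x) (∈Principal x))
  ... | inj₂ (inj₂ ⟨x⟩≡K) =
    let (a , 1≈ax) = proj₂ (⟨x⟩≡K 1#) tt in inj₂ (a , trans (*-comm x a) (sym 1≈ax))

  unit∉J : U x → ¬ J x
  unit∉J (w , xw≈1) jx = 1∉J (J-resp xw≈1 (J-*ʳ w jx))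

  unit? : ∀ x → Dec (U x)
  unit? x = [ (λ x∈J → no λ x-unit → unit∉J x-unit x∈J) , yes ]′ (J-or-unit x)

  ¬unit⇒J : ¬ U x → J x
  ¬unit⇒J {x} ¬unit = [ id , (λ unit → ⊥-elim (¬unit unit)) ]′ (J-or-unit x)

  1+J-unit : J x → U (1# + x)
  1+J-unit {x} jx with J-or-unit (1# + x)
  ... | inj₂ unit = unit
  ... | inj₁ j    = ⊥-elim (1∉J (J-resp (xyx⁻¹≈y x 1#) (J-− (J-resp (+-comm 1# x) j) jx)))

  x*unit≈0⇒x≈0 : U v → x * v ≈ 0# → x ≈ 0#
  x*unit≈0⇒x≈0 {v} {x} (w , vw≈1) xv≈0 = begin
    x             ≈⟨ *-identityʳ x ⟨
    x * 1#        ≈⟨ *-congˡ vw≈1 ⟨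
    x * (v * w)   ≈⟨ *-assoc x v w ⟨
    (x * v) * w   ≈⟨ *-congʳ xv≈0 ⟩
    0# * w        ≈⟨ zeroˡ w ⟩
    0#            ∎

  -- ⟨r²⟩ = J would give r = a r² and so r (1 − a r) = 0 with 1 − a r a unit.
  r*r≈0 : r * r ≈ 0#
  r*r≈0 with proj₂ (proj₂ three) (Principal R (r * r)) (Principal-isIdeal (r * r))
  ... | inj₁ ⟨r²⟩≡0        = proj₁ (⟨r²⟩≡0 (r * r)) (∈Principal (r * r))
  ... | inj₂ (inj₂ ⟨r²⟩≡K) = let (a , 1≈ar²) = proj₂ (⟨r²⟩≡K 1#) tt in
    ⊥-elim (1∉J (a * r , trans 1≈ar² (sym (*-assoc a r r))))
  ... | inj₂ (inj₁ ⟨r²⟩≡J) = let (a , r≈ar²) = proj₂ (⟨r²⟩≡J r) J-r in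
    ⊥-elim (r≉0 (x*unit≈0⇒x≈0 (1+J-unit (J-neg (J-*ˡ a J-r))) (begin
      r * (1# - a * r)         ≈⟨ distribˡ r 1# (- (a * r)) ⟩
      r * 1# + r * - (a * r)   ≈⟨ +-cong (*-identityʳ r) (sym (-‿distribʳ-* r (a * r))) ⟩
      r - r * (a * r)          ≈⟨ +-congˡ (-‿cong (trans (x∙yz≈y∙xz r a r) (sym r≈ar²))) ⟩
      r - r                    ≈⟨ -‿inverseʳ r ⟩
      0#                       ∎)))

  J*J≈0 : J x → J y → x * y ≈ 0#
  J*J≈0 {x} {y} (a , x≈ar) (b , y≈br) = begin
    x * y               ≈⟨ *-cong x≈ar y≈br ⟩
    (a * r) * (b * r)   ≈⟨ interchange a r b r ⟩
    (a * b) * (r * r)   ≈⟨ *-congˡ r*r≈0 ⟩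
    (a * b) * 0#        ≈⟨ zeroʳ (a * b) ⟩
    0#                  ∎

  *-congʳ-modJ : J (x - y) → J z → x * z ≈ y * z
  *-congʳ-modJ {x} {y} {z} jx-y jz =
    x∙y⁻¹≈ε⇒x≈y (x * z) (y * z) (trans (sym ([y-z]x≈yx-zx z x y)) (J*J≈0 jx-y jz))

  J-cancelʳ : U v → J (x * v) → J x
  J-cancelʳ {v} {x} (w , vw≈1) jxv = J-resp (begin
    (x * v) * w   ≈⟨ *-assoc x v w ⟩
    x * (v * w)   ≈⟨ *-congˡ vw≈1 ⟩
    x * 1#        ≈⟨ *-identityʳ x ⟩
    x             ∎) (J-*ʳ w jxv)

module Coordinates (R : CommutativeRing 0ℓ 0ℓ) (r : CommutativeRing.Carrier R)
                   (three : ExactlyThreeIdeals R r) {q} (qc : QuotientCard R r q)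
                   {N} {H : Tup R N → Set} (H-sub : IsSubspace R r H)
                   {d} (basis : HasBasis R r H d) where
  open CommutativeRing R hiding (zero) renaming (Carrier to K)
  open import Algebra.Properties.Ring ring using (-1*x≈-x)
  open import Relation.Binary.Reasoning.Setoid setoid
  open TupleAlgebra R
  open LocalRing R r three

  b : Fin d → Tup R N
  b = proj₁ basis

  b∈H : ∀ i → H (b i)
  b∈H = proj₁ (proj₂ basis)

  span : ∀ v → H v → ∃ λ (c : Fin d → K) → v ≐ linComb R c b
  span = proj₁ (proj₂ (proj₂ basis))

  independent : ∀ (c : Fin d → K) → linComb R c b ≐ zeroT R → ∀ i → J (c i)
  independent = proj₂ (proj₂ (proj₂ basis))

  rep : Fin q → K
  rep = Count.elt qc

  rep-index : K → Fin q
  rep-index x = proj₁ (Count.cover qc x tt)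

  x-rep∈J : ∀ x → J (x - rep (rep-index x))
  x-rep∈J x = proj₂ (Count.cover qc x tt)

  rep-injective : ∀ i j → J (rep i - rep j) → i ≡ j
  rep-injective = Count.distinct qc

  ψ : (Fin d → K) → Tup R N
  ψ c = linComb R c b

  ψ-∈H : ∀ c → H (ψ c)
  ψ-∈H c = linComb-∈ H-sub c b b∈H

  ψ-∈T : ∀ c → InT R r (ψ c)
  ψ-∈T c = proj₁ (proj₂ H-sub) (ψ c) (ψ-∈H c)

  b∈T : ∀ i → InT R r (b i)
  b∈T i = proj₁ (proj₂ H-sub) (b i) (b∈H i)

  ψ-J≐0 : ∀ {c} → (∀ i → J (c i)) → ψ c ≐ zeroT R
  ψ-J≐0 c∈J = linComb-zero b λ i j → J*J≈0 (c∈J i) (b∈T i j)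

  ψ-cong-modJ : ∀ {c c'} → (∀ i → J (c i - c' i)) → ψ c ≐ ψ c'
  ψ-cong-modJ c≡c' j = linComb-termwise b j λ i → *-congʳ-modJ (c≡c' i) (b∈T i j)

  ψ-injective-modJ : ∀ c c' → ψ c ≐ ψ c' → ∀ i → J (c i - c' i)
  ψ-injective-modJ c c' ψc≐ψc' i =
    J-resp (+-congˡ (-1*x≈-x (c' i))) (independent (c ⊞ - 1# · c') ψ[c-c']≐0 i)
    where
      ψ[c-c']≐0 : ψ (c ⊞ - 1# · c') ≐ zeroT R
      ψ[c-c']≐0 j = begin
        ψ (c ⊞ - 1# · c') j        ≈⟨ linComb-⊞ b c (- 1# · c') j ⟩
        ψ c j + ψ (- 1# · c') j    ≈⟨ +-congˡ (linComb-· b (- 1#) c' j) ⟩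
        ψ c j + - 1# * ψ c' j      ≈⟨ +-cong (ψc≐ψc' j) (-1*x≈-x (ψ c' j)) ⟩
        ψ c' j - ψ c' j            ≈⟨ -‿inverseʳ (ψ c' j) ⟩
        0#                         ∎

  count-H : Count H _≐_ (q ^ d)
  count-H = Count-fromFunctions ≋-trans (ψ ∘ (rep ∘_))
    (λ g≗g' → linComb-cong b (λ i → reflexive (≡.cong rep (g≗g' i))))
    (ψ-∈H ∘ (rep ∘_))
    (λ {g} {g'} ψg≐ψg' i → rep-injective _ _ (ψ-injective-modJ (rep ∘ g) (rep ∘ g') ψg≐ψg' i))
    (λ a a∈H → let (α , a≐ψα) = span a a∈H in
      rep-index ∘ α , ≋-trans a≐ψα (ψ-cong-modJ (x-rep∈J ∘ α)))

module Shifts (R : CommutativeRing 0ℓ 0ℓ) (r : CommutativeRing.Carrier R)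
              (three : ExactlyThreeIdeals R r) {n} (u : Tup R n) (u∈V' : InV' R u) where
  open CommutativeRing R hiding (zero) renaming (Carrier to K)
  open import Algebra.Properties.Ring ring using ([y-z]x≈yx-zx; xyx⁻¹≈y; x≈z//y; //-rightDividesˡ)
  open import Relation.Binary.Reasoning.Setoid setoid
  open TupleAlgebra R
  open LocalRing R r three

  ru : Tup R n
  ru = r · u

  infix 4 _~_

  _~_ : Tup R n → Tup R n → Set
  h ~ h' = SameClass R (u ⊞ h) (u ⊞ h')

  ~-trans : Transitive _~_
  ~-trans = SameClass-trans

  ≐⇒~ : ∀ {h h'} → h ≐ h' → h ~ h'
  ≐⇒~ {h} {h'} h≐h' = sameClass-· unit-1 λ j →
    trans (+-congˡ (sym (h≐h' j))) (sym (*-identityˡ (u j + h j)))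

  [1+sr]·[u⊞h]≐u⊞[h⊞s·ru] : ∀ s {h} → InT R r h →
                            (1# + s * r) · (u ⊞ h) ≐ u ⊞ (h ⊞ s · ru)
  [1+sr]·[u⊞h]≐u⊞[h⊞s·ru] s {h} h∈T j = begin
    (1# + s * r) * (u j + h j)               ≈⟨ distribʳ (u j + h j) 1# (s * r) ⟩
    1# * (u j + h j) + (s * r) * (u j + h j) ≈⟨ +-cong (*-identityˡ _) (*-assoc s r (u j + h j)) ⟩
    (u j + h j) + s * (r * (u j + h j))      ≈⟨ +-congˡ (*-congˡ (distribˡ r (u j) (h j))) ⟩
    (u j + h j) + s * (r * u j + r * h j)    ≈⟨ +-congˡ (*-congˡ (+-congˡ (J*J≈0 J-r (h∈T j)))) ⟩
    (u j + h j) + s * (r * u j + 0#)         ≈⟨ +-congˡ (*-congˡ (+-identityʳ (r * u j))) ⟩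
    (u j + h j) + s * (r * u j)              ≈⟨ +-assoc (u j) (h j) (s * (r * u j)) ⟩
    u j + (h j + s * (r * u j))              ∎

  shift-~ : ∀ s {h} → InT R r h → h ~ h ⊞ s · ru
  shift-~ s h∈T = sameClass-· (1+J-unit (J-*ˡ s J-r)) (≋-sym ([1+sr]·[u⊞h]≐u⊞[h⊞s·ru] s h∈T))

  -- Compare the coordinates at a unit entry u j₀ modulo J, where h and h' vanish.
  factor-1∈J : ∀ {h h' l} → InT R r h → InT R r h' → u ⊞ h' ≐ l · (u ⊞ h) → J (l - 1#)
  factor-1∈J {h} {h'} {l} h∈T h'∈T u⊞h'≐l·[u⊞h] =
    J-cancelʳ (proj₂ u∈V') (J-resp (sym [l-1]A≈B'-lB) (J-− (h'∈T j₀) (J-*ˡ l (h∈T j₀))))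
    where
      j₀ = proj₁ u∈V'
      A = u j₀
      B = h j₀
      B' = h' j₀
      [l-1]A≈B'-lB : (l - 1#) * A ≈ B' - l * B
      [l-1]A≈B'-lB = begin
        (l - 1#) * A            ≈⟨ [y-z]x≈yx-zx A l 1# ⟩
        l * A - 1# * A          ≈⟨ +-congˡ (-‿cong (*-identityˡ A)) ⟩
        l * A - A               ≈⟨ +-congʳ (x≈z//y (l * A) (l * B) (A + B')
                                     (trans (sym (distribˡ l A B)) (sym (u⊞h'≐l·[u⊞h] j₀)))) ⟩
        (A + B') - l * B - A    ≈⟨ +-congʳ (+-assoc A B' (- (l * B))) ⟩
        A + (B' - l * B) - A    ≈⟨ xyx⁻¹≈y A (B' - l * B) ⟩
        B' - l * B              ∎

  ~⇒shift : ∀ {h h'} → InT R r h → InT R r h' → h ~ h' → ∃ λ s → h' ≐ h ⊞ s · ru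
  ~⇒shift {h} {h'} h∈T h'∈T h~h' with sameClass⇒· h~h'
  ... | l , _ , u⊞h'≐l·[u⊞h] with factor-1∈J h∈T h'∈T u⊞h'≐l·[u⊞h]
  ... | s , l-1≈sr = s , λ j → begin
    h' j                                ≈⟨ xyx⁻¹≈y (u j) (h' j) ⟨
    (u j + h' j) - u j                  ≈⟨ +-congʳ (u⊞h'≐l·[u⊞h] j) ⟩
    l * (u j + h j) - u j               ≈⟨ +-congʳ (*-congʳ l≈1+sr) ⟩
    (1# + s * r) * (u j + h j) - u j    ≈⟨ +-congʳ ([1+sr]·[u⊞h]≐u⊞[h⊞s·ru] s h∈T j) ⟩
    u j + (h j + s * (r * u j)) - u j   ≈⟨ xyx⁻¹≈y (u j) _ ⟩
    h j + s * (r * u j)                 ∎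
    where
      l≈1+sr : l ≈ 1# + s * r
      l≈1+sr = begin
        l               ≈⟨ //-rightDividesˡ 1# l ⟨
        (l - 1#) + 1#   ≈⟨ +-congʳ l-1≈sr ⟩
        s * r + 1#      ≈⟨ +-comm (s * r) 1# ⟩
        1# + s * r      ∎

  shift-J : ∀ {s} h → J s → h ⊞ s · ru ≐ h
  shift-J {s} h s∈J j = begin
    h j + s * (r * u j)     ≈⟨ +-congˡ (*-assoc s r (u j)) ⟨
    h j + (s * r) * u j     ≈⟨ +-congˡ (*-congʳ (J*J≈0 s∈J J-r)) ⟩
    h j + 0# * u j          ≈⟨ +-congˡ (zeroˡ (u j)) ⟩
    h j + 0#                ≈⟨ +-identityʳ (h j) ⟩
    h j                     ∎

  ru≉0 : ¬ ru ≐ zeroT R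
  ru≉0 ru≐0 = r≉0 (x*unit≈0⇒x≈0 (proj₂ u∈V') (ru≐0 (proj₁ u∈V')))

module Hyperplane (R : CommutativeRing 0ℓ 0ℓ) (r : CommutativeRing.Carrier R)
                  (three : ExactlyThreeIdeals R r) {q} (qc : QuotientCard R r q)
                  {N} {H : Tup R N → Set} (H-sub : IsSubspace R r H)
                  (u : Tup R N) (u∈V' : InV' R u) where
  open CommutativeRing R hiding (zero) renaming (Carrier to K)
  open import Algebra.Properties.Ring ring
    using (-1*x≈-x; -‿involutive; -‿distribˡ-*; xyx⁻¹≈y; x≈y⇒x∙y⁻¹≈ε)
  open import Relation.Binary.Reasoning.Setoid setoid
  open TupleAlgebra R
  open LocalRing R r three
  open Shifts R r three u u∈V'

  H-resp : ∀ {v w} → v ≐ w → H v → H w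
  H-resp = proj₁ H-sub

  H⊆T : ∀ v → H v → InT R r v
  H⊆T = proj₁ (proj₂ H-sub)

  H-⊞ : ∀ v w → H v → H w → H (v ⊞ w)
  H-⊞ = proj₁ (proj₂ (proj₂ (proj₂ H-sub)))

  H-· : ∀ a v → H v → H (a · v)
  H-· = proj₂ (proj₂ (proj₂ (proj₂ H-sub)))

  -- A unit shift s would put ru = s⁻¹ (h' − h) in H.
  ~⇒≐ : ¬ H ru → ∀ {h h'} → H h → H h' → h ~ h' → h ≐ h'
  ~⇒≐ ru∉H {h} {h'} h∈H h'∈H h~h' with ~⇒shift (H⊆T h h∈H) (H⊆T h' h'∈H) h~h'
  ... | s , h'≐h⊞s·ru with J-or-unit s
  ...   | inj₁ s∈J = ≋-sym (≋-trans h'≐h⊞s·ru (shift-J h s∈J))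
  ...   | inj₂ (w , sw≈1) =
    ⊥-elim (ru∉H (H-resp w·[h'-h]≐ru (H-· w _ (H-⊞ _ _ h'∈H (H-· (- 1#) h h∈H)))))
    where
      w·[h'-h]≐ru : w · (h' ⊞ - 1# · h) ≐ ru
      w·[h'-h]≐ru j = begin
        w * (h' j + - 1# * h j)           ≈⟨ *-congˡ (+-cong (h'≐h⊞s·ru j) (-1*x≈-x (h j))) ⟩
        w * ((h j + s * ru j) - h j)      ≈⟨ *-congˡ (xyx⁻¹≈y (h j) (s * ru j)) ⟩
        w * (s * ru j)                    ≈⟨ *-assoc w s (ru j) ⟨
        (w * s) * ru j                    ≈⟨ *-congʳ (trans (*-comm w s) sw≈1) ⟩
        1# * ru j                         ≈⟨ *-identityˡ (ru j) ⟩
        ru j                              ∎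

  module _ {d} (basis : HasBasis R r H d) where
    open Coordinates R r three qc H-sub basis

    count-classes-∉ : ¬ H ru → Count H _~_ (q ^ d)
    count-classes-∉ ru∉H = Count-resp-⇔ (λ _ _ → ≐⇒~) (~⇒≐ ru∉H) count-H

    unit-coordinate : ∀ {γ} → ru ≐ ψ γ → ∃ λ i → U (γ i)
    unit-coordinate {γ} ru≐ψγ with any? (unit? ∘ γ)
    ... | yes found = found
    ... | no none   =
      ⊥-elim (ru≉0 (≋-trans ru≐ψγ (ψ-J≐0 λ i → ¬unit⇒J λ unit → none (i , unit))))

  module Transversal {d} (basis : HasBasis R r H (suc d)) (γ : Fin (suc d) → K)
                     (ru≐ψγ : ru ≐ linComb R γ (proj₁ basis))
                     (i₀ : Fin (suc d)) (γᵢ₀-unit : U (γ i₀)) where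
    open Coordinates R r three qc H-sub basis

    β : (Fin d → Fin q) → Fin (suc d) → K
    β g = insertAt (rep ∘ g) i₀ 0#

    β-cong : ∀ {g g'} → g ≗ g' → β g ≐ β g'
    β-cong g≗g' = insertAt-pointwise _≈_ (λ m → reflexive (≡.cong rep (g≗g' m))) i₀ refl

    ψ-shift : ∀ c s → ψ c ⊞ s · ru ≐ ψ (c ⊞ s · γ)
    ψ-shift c s j = sym (begin
      ψ (c ⊞ s · γ) j            ≈⟨ linComb-⊞ b c (s · γ) j ⟩
      ψ c j + ψ (s · γ) j        ≈⟨ +-congˡ (linComb-· b s γ j) ⟩
      ψ c j + s * ψ γ j          ≈⟨ +-congˡ (*-congˡ (ru≐ψγ j)) ⟨
      ψ c j + s * ru j           ∎)

    -- The i₀-th coordinate of a shift between two elements ψ (β g) is s γᵢ₀, so s ∈ J.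
    ψβ-injective : ∀ {g g'} → ψ (β g) ~ ψ (β g') → g ≗ g'
    ψβ-injective {g} {g'} βg~βg' with ~⇒shift (ψ-∈T (β g)) (ψ-∈T (β g')) βg~βg'
    ... | s , ψβg'≐ψβg⊞s·ru = λ m → ≡.sym (rep-injective _ _ (≡.subst₂ (λ x y → J (x - y))
      (insertAt-punchIn (rep ∘ g') i₀ 0# m) (insertAt-punchIn (rep ∘ g) i₀ 0# m)
      (ψ-injective-modJ (β g') (β g) ψβg'≐ψβg (punchIn i₀ m))))
      where
        coordinate-i₀ : J (β g' i₀ - (β g i₀ + s * γ i₀))
        coordinate-i₀ =
          ψ-injective-modJ (β g') (β g ⊞ s · γ) (≋-trans ψβg'≐ψβg⊞s·ru (ψ-shift (β g) s)) i₀
        s∈J : J s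
        s∈J = J-cancelʳ γᵢ₀-unit (J-resp (begin
          - (β g' i₀ - (β g i₀ + s * γ i₀))   ≡⟨ ≡.cong₂ (λ x y → - (x - (y + s * γ i₀)))
                                                   (insertAt-lookup (rep ∘ g') i₀ 0#)
                                                   (insertAt-lookup (rep ∘ g) i₀ 0#) ⟩
          - (0# - (0# + s * γ i₀))            ≈⟨ -‿cong (+-identityˡ _) ⟩
          - - (0# + s * γ i₀)                 ≈⟨ -‿involutive _ ⟩
          0# + s * γ i₀                       ≈⟨ +-identityˡ _ ⟩
          s * γ i₀                            ∎) (J-neg coordinate-i₀))
        ψβg'≐ψβg : ψ (β g') ≐ ψ (β g)
        ψβg'≐ψβg = ≋-trans ψβg'≐ψβg⊞s·ru (shift-J (ψ (β g)) s∈J)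

    -- Shifting by s·ru with s = −αᵢ₀ γᵢ₀⁻¹ clears the i₀-th coordinate.
    ψβ-cover : ∀ a → H a → ∃ λ g → a ~ ψ (β g)
    ψβ-cover a a∈H = g , ~-trans (shift-~ s (H⊆T a a∈H)) (≐⇒~ a⊞s·ru≐ψβg)
      where
        α = proj₁ (span a a∈H)
        w = proj₁ γᵢ₀-unit
        s = - (α i₀ * w)
        α' = α ⊞ s · γ
        wγᵢ₀≈1 : w * γ i₀ ≈ 1#
        wγᵢ₀≈1 = trans (*-comm w (γ i₀)) (proj₂ γᵢ₀-unit)
        α'ᵢ₀≈0 : α' i₀ ≈ 0#
        α'ᵢ₀≈0 = begin
          α i₀ + - (α i₀ * w) * γ i₀     ≈⟨ +-congˡ (-‿distribˡ-* (α i₀ * w) (γ i₀)) ⟨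
          α i₀ + - (α i₀ * w * γ i₀)     ≈⟨ +-congˡ (-‿cong (*-assoc (α i₀) w (γ i₀))) ⟩
          α i₀ - α i₀ * (w * γ i₀)       ≈⟨ +-congˡ (-‿cong (*-congˡ wγᵢ₀≈1)) ⟩
          α i₀ - α i₀ * 1#               ≈⟨ +-congˡ (-‿cong (*-identityʳ (α i₀))) ⟩
          α i₀ - α i₀                    ≈⟨ -‿inverseʳ (α i₀) ⟩
          0#                             ∎
        g = rep-index ∘ removeAt α' i₀
        α'≡βg : ∀ k → J (α' k - β g k)
        α'≡βg k = ≡.subst (λ x → J (x - β g k)) (insertAt-removeAt α' i₀ k)
          (insertAt-pointwise (λ x y → J (x - y)) (x-rep∈J ∘ removeAt α' i₀) i₀
            (J-resp (sym (x≈y⇒x∙y⁻¹≈ε α'ᵢ₀≈0)) J-0) k)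
        a⊞s·ru≐ψβg : a ⊞ s · ru ≐ ψ (β g)
        a⊞s·ru≐ψβg = ≋-trans (λ j → +-congʳ (proj₂ (span a a∈H) j))
                       (≋-trans (ψ-shift α s) (ψ-cong-modJ α'≡βg))

    count-classes : Count H _~_ (q ^ d)
    count-classes = Count-fromFunctions ~-trans (ψ ∘ β) (≐⇒~ ∘ linComb-cong b ∘ β-cong)
      (ψ-∈H ∘ β) ψβ-injective ψβ-cover

  count-classes-∈ : ∀ {d} → HasBasis R r H d → H ru → ∃ λ m → Count H _~_ m × m ℕ.* q ≡ q ^ d
  count-classes-∈ basis ru∈H =
    let (γ , ru≐ψγ) = span ru ru∈H ; (i₀ , γᵢ₀-unit) = unit-coordinate basis ru≐ψγ
    in count-classes-at basis γ ru≐ψγ i₀ γᵢ₀-unit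
    where
      open Coordinates R r three qc H-sub basis using (span)
      count-classes-at : ∀ {d} (basis : HasBasis R r H d) γ → ru ≐ linComb R γ (proj₁ basis) →
                         (i₀ : Fin d) → U (γ i₀) → ∃ λ m → Count H _~_ m × m ℕ.* q ≡ q ^ d
      count-classes-at {zero}  _ _ _ () _
      count-classes-at {suc d} basis γ ru≐ψγ i₀ γᵢ₀-unit =
        q ^ d , Transversal.count-classes basis γ ru≐ψγ i₀ γᵢ₀-unit , ℕₚ.*-comm (q ^ d) q

open import Data.Nat using (_*_; _≤_)

lemma3p4 : (R : CommutativeRing 0ℓ 0ℓ) (r : CommutativeRing.Carrier R) (q e : ℕ) →
  IsFinite R → ExactlyThreeIdeals R r → QuotientCard R r q → 2 ≤ e →
  (H : Tup R (2 * e) → Set) → IsHyperplane R r e H →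
  (u : Tup R (2 * e)) → InV' R u →
  (H (scale R r u) → ∃₂ λ n m → Count H (_≋_ R) n
                        × Count H (λ h h' → SameClass R (_⊕_ R u h) (_⊕_ R u h')) m
                        × m * q ≡ n)
  × (¬ H (scale R r u) → ∃ λ n → Count H (_≋_ R) n
                        × Count H (λ h h' → SameClass R (_⊕_ R u h) (_⊕_ R u h')) n)
lemma3p4 R r q e _ three qc _ H (H-sub , basis) u u∈V' =
    (λ ru∈H → let (m , classes , m*q≡n) = count-classes-∈ basis ru∈H in
      _ , m , count-H , classes , m*q≡n)
  , (λ ru∉H → _ , count-H , count-classes-∉ basis ru∉H)
  where
    open Hyperplane R r three qc H-sub u u∈V'
    open Coordinates R r three qc H-sub basis using (count-H)
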